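{- Let $b\geq 1$ be odd and $n>b$. Then the set $R_n^*(b)$, listed in increasing Reflected Gray Code Order $\prec$, is a $5$-Gray code: any two consecutive sequences in this list differ in at most $5$ positions.
   Context: A restricted growth function of length $n$ is an integer sequence $s_1s_2\ldots s_n$ with $s_1=0$ and $0\leq s_{i+1}\leq \max\{s_j\}_{j=1}^{i}+1$ for all $1\leq i\leq n-1$; $R_n$ denotes the set of these. For an integer $b\geq 1$, $R_n^*(b)=\{s_1\ldots s_n\in R_n : \max_i s_i= b\}$. For integers $m\geq 2$, $n\geq1$, the Reflected Gray Code Order $\prec$ on $\{0,1,\ldots,m-1\}^n$ is defined by: $s_1\ldots s_n\prec t_1\ldots t_n$ if there is $k$ with $s_i=t_i$ for $1\leq i\leq k-1$, $s_k\neq t_k$, and either $\sum_{i=1}^{k-1}s_i$ is even and $s_k<t_k$, or $\sum_{i=1}^{k-1}s_i$ is odd and $s_k>t_k$. (The relative order does not depend on $m$.) The Hamming distance between two equal-length sequences is the number of positions in which they differ; a list is a $d$-Gray code if consecutive sequences have Hamming distance at most $d$. -}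

module Defs where

open import Data.Nat using (ℕ; zero; suc; _+_; _≤_; _<_; _⊔_; _%_; _≡ᵇ_)
open import Data.List using (List; []; _∷_; foldr; length)
open import Data.Product using (_×_)
open import Data.Sum using (_⊎_)
open import Data.Unit using (⊤)
open import Data.Empty using (⊥)
open import Data.Bool using (if_then_else_)
open import Relation.Binary.PropositionalEquality using (_≡_; _≢_)

RGFFrom : ℕ → List ℕ → Set
RGFFrom m []       = ⊤
RGFFrom m (x ∷ xs) = x ≤ suc m × RGFFrom (m ⊔ x) xs

IsRGF : List ℕ → Set
IsRGF []       = ⊥
IsRGF (x ∷ xs) = x ≡ 0 × RGFFrom x xs

maxL : List ℕ → ℕ
maxL = foldr _⊔_ 0

InRStar : ℕ → ℕ → List ℕ → Set
InRStar n b s = length s ≡ n × IsRGF s × maxL s ≡ b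

-- Reflected Gray Code order; acc is the sum of the common prefix so far
RGCFrom : ℕ → List ℕ → List ℕ → Set
RGCFrom acc (x ∷ xs) (y ∷ ys) =
  (x ≡ y × RGCFrom (acc + x) xs ys)
  ⊎ (x ≢ y × ((acc % 2 ≡ 0 × x < y) ⊎ (acc % 2 ≡ 1 × y < x)))
RGCFrom acc _ _ = ⊥

_≺_ : List ℕ → List ℕ → Set
s ≺ t = RGCFrom 0 s t

-- Hamming distance (on equal-length sequences)
hamming : List ℕ → List ℕ → ℕ
hamming (x ∷ xs) (y ∷ ys) = (if x ≡ᵇ y then 0 else 1) + hamming xs ys
hamming _ _ = 0

module Submission where

-- After a common prefix with current maximum K and prefix-sum parity π, the
-- ≺-least valid tail of length r is computed greedily by 'least K π r' (even
-- parity: smallest admissible head; odd parity: largest).  Raising the prefix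
-- sum by one reverses the order, so the ≺-largest tail is 'least' with the
-- opposite parity.  If s ≺ t are consecutive with first difference x < y under
-- even parity (odd parity reduces to this by reversal), then y = x + 1, the tail
-- of s is largest and the tail of t least, both from the same parity and with
-- maxima differing by at most one.  The bound 1 + 4 then follows from 'shift':
-- for odd b the least tails from maxima K and K + 1 differ in at most 4 places.

open import Defs
open import Data.Nat
  using (ℕ; zero; suc; _+_; parity; _≤_; _<_; _⊔_; _%_; _≡ᵇ_; _≤?_; _<?_; _≟_; z≤n; s≤s)
open import Data.Nat.Properties
open import Data.Parity.Base using (Parity; 0ℙ; 1ℙ; _⁻¹)
import Data.Parity.Base as ℙ
open import Data.Parity.Properties using (suc-homo-⁻¹; +-homo-+)
open import Algebra.Properties.CommutativeSemigroup +-commutativeSemigroup using (interchange)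
open import Data.Bool using (true; false; T; if_then_else_)
open import Data.List using (List; []; _∷_; length)
open import Data.Product using (_×_; _,_)
open import Data.Sum using (_⊎_; inj₁; inj₂)
import Data.Sum as Sum
open import Data.Empty using (⊥-elim)
open import Data.Unit using (tt)
open import Function using (_∘_)
open import Relation.Nullary using (¬_; yes; no)
open import Relation.Binary.PropositionalEquality
  using (_≡_; refl; sym; trans; cong; cong₂; subst; module ≡-Reasoning)

-- Parity and residues mod 2

bit : Parity → ℕ
bit 0ℙ = 0
bit 1ℙ = 1

-- The Gray order is phrased with 'a % 2'; the least tails with 'parity a'.
parity⇒%2 : ∀ a {π} → parity a ≡ π → a % 2 ≡ bit π
parity⇒%2 zero          refl = refl
parity⇒%2 (suc zero)    refl = refl
parity⇒%2 (suc (suc a)) p    = parity⇒%2 a p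

suc-even⇒odd : ∀ a → suc a % 2 ≡ 0 → a % 2 ≡ 1
suc-even⇒odd zero          ()
suc-even⇒odd (suc zero)    _ = refl
suc-even⇒odd (suc (suc a)) e = suc-even⇒odd a e

suc-odd⇒even : ∀ a → suc a % 2 ≡ 1 → a % 2 ≡ 0
suc-odd⇒even zero          _ = refl
suc-odd⇒even (suc zero)    ()
suc-odd⇒even (suc (suc a)) e = suc-odd⇒even a e

odd⇒suc-even : ∀ a → a % 2 ≡ 1 → suc a % 2 ≡ 0
odd⇒suc-even zero          ()
odd⇒suc-even (suc zero)    _ = refl
odd⇒suc-even (suc (suc a)) e = odd⇒suc-even a e

parity-step : ∀ a x {π} → parity a ≡ π → parity (a + x) ≡ π ℙ.+ parity x
parity-step a x refl = +-homo-+ a x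

-- Hamming distance

mismatch : ℕ → ℕ → ℕ
mismatch x y = if x ≡ᵇ y then 0 else 1

mismatch-refl : ∀ x → mismatch x x ≡ 0
mismatch-refl zero    = refl
mismatch-refl (suc x) = mismatch-refl x

mismatch-sym : ∀ x y → mismatch x y ≡ mismatch y x
mismatch-sym zero    zero    = refl
mismatch-sym zero    (suc y) = refl
mismatch-sym (suc x) zero    = refl
mismatch-sym (suc x) (suc y) = mismatch-sym x y

mismatch≤1 : ∀ x y → mismatch x y ≤ 1
mismatch≤1 x y with x ≡ᵇ y
... | true  = z≤n
... | false = s≤s z≤n

mismatch-triangle : ∀ x y z → mismatch x z ≤ mismatch x y + mismatch y z
mismatch-triangle x y z with x ≡ᵇ y in x≡ᵇy
... | true rewrite ≡ᵇ⇒≡ x y (subst T (sym x≡ᵇy) tt) = ≤-refl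
... | false = ≤-trans (mismatch≤1 x z) (m≤m+n 1 (mismatch y z))

hamming-refl : ∀ xs → hamming xs xs ≡ 0
hamming-refl []       = refl
hamming-refl (x ∷ xs) = cong₂ _+_ (mismatch-refl x) (hamming-refl xs)

hamming-≡ : ∀ {xs ys} → xs ≡ ys → hamming xs ys ≡ 0
hamming-≡ {xs} refl = hamming-refl xs

hamming-sym : ∀ xs ys → hamming xs ys ≡ hamming ys xs
hamming-sym []       []       = refl
hamming-sym []       (y ∷ ys) = refl
hamming-sym (x ∷ xs) []       = refl
hamming-sym (x ∷ xs) (y ∷ ys) = cong₂ _+_ (mismatch-sym x y) (hamming-sym xs ys)

hamming-same-head : ∀ x xs ys → hamming (x ∷ xs) (x ∷ ys) ≡ hamming xs ys
hamming-same-head x xs ys = cong (_+ hamming xs ys) (mismatch-refl x)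

hamming-cons : ∀ x y xs ys → hamming (x ∷ xs) (y ∷ ys) ≤ suc (hamming xs ys)
hamming-cons x y xs ys = +-monoˡ-≤ (hamming xs ys) (mismatch≤1 x y)

hamming-triangle : ∀ xs ys zs → length xs ≡ length ys →
  hamming xs zs ≤ hamming xs ys + hamming ys zs
hamming-triangle []       ys       zs       _ = z≤n
hamming-triangle (x ∷ xs) (y ∷ ys) []       _ = z≤n
hamming-triangle (x ∷ xs) (y ∷ ys) (z ∷ zs) e = ≤-trans
  (+-mono-≤ (mismatch-triangle x y z) (hamming-triangle xs ys zs (suc-injective e)))
  (≤-reflexive (interchange (mismatch x y) (mismatch y z) (hamming xs ys) (hamming ys zs)))

-- The Reflected Gray Code order

same-head : ∀ {a x u w} → u ≡ w ⊎ RGCFrom (a + x) u w →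
  x ∷ u ≡ x ∷ w ⊎ RGCFrom a (x ∷ u) (x ∷ w)
same-head {x = x} = Sum.map (cong (x ∷_)) (λ u≺w → inj₁ (refl , u≺w))

reverse : ∀ a u w → RGCFrom (suc a) u w → RGCFrom a w u
reverse a (x ∷ u) (y ∷ w) (inj₁ (refl , u≺w)) = inj₁ (refl , reverse (a + x) u w u≺w)
reverse a (x ∷ u) (y ∷ w) (inj₂ (x≢y , inj₁ (even , x<y))) =
  inj₂ (x≢y ∘ sym , inj₂ (suc-even⇒odd a even , x<y))
reverse a (x ∷ u) (y ∷ w) (inj₂ (x≢y , inj₂ (odd , y<x))) =
  inj₂ (x≢y ∘ sym , inj₁ (suc-odd⇒even a odd , y<x))

⊔-suc : ∀ K x → K ⊔ suc x ≡ K ⊔ x ⊎ K ⊔ suc x ≡ suc (K ⊔ x)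
⊔-suc zero    x       = inj₂ refl
⊔-suc (suc K) zero    = inj₁ (cong suc (⊔-identityʳ K))
⊔-suc (suc K) (suc x) = Sum.map (cong suc) (cong suc) (⊔-suc K x)

-- Tails of restricted growth functions with maximum b

module Tails (b : ℕ) where

  -- w is a valid continuation of a prefix whose maximum so far is K.
  record Valid (K : ℕ) (w : List ℕ) : Set where
    constructor valid
    field
      growth  : RGFFrom K w
      maximum : K ⊔ maxL w ≡ b

  -- A state (K, r) admits a valid tail of length r exactly when K ≤ b ≤ K + r.
  record Feasible (K r : ℕ) : Set where
    constructor feasible
    field
      below : K ≤ b
      reach : b ≤ K + r
  open Feasible

  valid-tail : ∀ {K x w K′} → K ⊔ x ≡ K′ → Valid K (x ∷ w) → Valid K′ w
  valid-tail {K} {x} {w} refl (valid (_ , g) m) = valid g (trans (⊔-assoc K x (maxL w)) m)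

  valid-cons : ∀ {K x w K′} → x ≤ suc K → K ⊔ x ≡ K′ → Valid K′ w → Valid K (x ∷ w)
  valid-cons {K} {x} {w} x≤ refl (valid g m) = valid (x≤ , g) (trans (sym (⊔-assoc K x (maxL w))) m)

  head-growth : ∀ {K x w} → Valid K (x ∷ w) → x ≤ suc K
  head-growth (valid (x≤ , _) _) = x≤

  valid⇒feasible : ∀ {K} w → Valid K w → Feasible K (length w)
  valid⇒feasible {K} [] (valid _ m) =
    feasible (≤-reflexive K≡b) (≤-reflexive (trans (sym K≡b) (sym (+-identityʳ K))))
    where K≡b = trans (sym (⊔-identityʳ K)) m
  valid⇒feasible {K} (x ∷ w) v with valid⇒feasible w (valid-tail refl v)
  ... | feasible K⊔x≤b b≤ = feasible (≤-trans (m≤m⊔n K x) K⊔x≤b) (begin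
    b                       ≤⟨ b≤ ⟩
    K ⊔ x + length w        ≤⟨ +-monoˡ-≤ (length w) (⊔-lub (n≤1+n K) (head-growth v)) ⟩
    suc K + length w        ≡⟨ sym (+-suc K (length w)) ⟩
    K + suc (length w)      ∎)
    where open ≤-Reasoning

  head≤b : ∀ {K x w} → Valid K (x ∷ w) → x ≤ b
  head≤b {K} {x} {w} v = ≤-trans (m≤n⊔m K x) (below (valid⇒feasible w (valid-tail refl v)))

  K⊔sK : ∀ K → K ⊔ suc K ≡ suc K
  K⊔sK K = m≤n⇒m⊔n≡n (n≤1+n K)

  -- The ≺-least tail of length r from maximum K and prefix parity π.
  least : ℕ → Parity → ℕ → List ℕ
  least K π zero = []
  least K 0ℙ (suc r) with b ≤? K + r
  ... | yes _ = 0 ∷ least K 0ℙ r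
  ... | no  _ = suc K ∷ least (suc K) (parity (suc K)) r
  least K 1ℙ (suc r) with K <? b
  ... | yes _ = suc K ∷ least (suc K) (parity (suc K) ⁻¹) r
  ... | no  _ = b ∷ least K (parity b ⁻¹) r

  least-length : ∀ K π r → length (least K π r) ≡ r
  least-length K π  zero = refl
  least-length K 0ℙ (suc r) with b ≤? K + r
  ... | yes _ = cong suc (least-length K 0ℙ r)
  ... | no  _ = cong suc (least-length (suc K) _ r)
  least-length K 1ℙ (suc r) with K <? b
  ... | yes _ = cong suc (least-length (suc K) _ r)
  ... | no  _ = cong suc (least-length K _ r)

  least-room : ∀ {K r} → b ≤ K + r → least K 0ℙ (suc r) ≡ 0 ∷ least K 0ℙ r
  least-room {K} {r} room with b ≤? K + r
  ... | yes _    = refl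
  ... | no  full = ⊥-elim (full room)

  least-climb : ∀ {K r} → K < b → least K 1ℙ (suc r) ≡ suc K ∷ least (suc K) (parity (suc K) ⁻¹) r
  least-climb {K} K<b with K <? b
  ... | yes _   = refl
  ... | no  K≮b = ⊥-elim (K≮b K<b)

  -- With exactly enough room the head is forced to be K + 1 (the tail is the
  -- staircase K+1, K+2, ...)
  least-tight : ∀ K π r → b ≡ K + suc r →
    least K π (suc r) ≡ suc K ∷ least (suc K) (π ℙ.+ parity (suc K)) r
  least-tight K 0ℙ r tight with b ≤? K + r
  ... | yes room = ⊥-elim (<⇒≱ (subst (K + r <_) (sym tight) (+-monoʳ-< K (n<1+n r))) room)
  ... | no  _    = refl
  least-tight K 1ℙ r tight with K <? b
  ... | yes _   = refl
  ... | no  K≮b = ⊥-elim (K≮b (subst (K <_) (sym tight) (m<m+n K (s≤s z≤n))))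

  least-rigid : ∀ K π π′ r → b ≡ K + r → least K π r ≡ least K π′ r
  least-rigid K π π′ zero    _     = refl
  least-rigid K π π′ (suc r) tight = begin
    least K π (suc r)                                 ≡⟨ least-tight K π r tight ⟩
    suc K ∷ least (suc K) (π ℙ.+ parity (suc K)) r
      ≡⟨ cong (suc K ∷_) (least-rigid (suc K) _ _ r (trans tight (+-suc K r))) ⟩
    suc K ∷ least (suc K) (π′ ℙ.+ parity (suc K)) r  ≡⟨ sym (least-tight K π′ r tight) ⟩
    least K π′ (suc r)                                ∎
    where open ≡-Reasoning

  least-valid : ∀ K π r → Feasible K r → Valid K (least K π r)
  least-valid K π zero (feasible K≤b b≤) =
    valid tt (trans (⊔-identityʳ K) (≤-antisym K≤b (subst (b ≤_) (+-identityʳ K) b≤)))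
  least-valid K 0ℙ (suc r) (feasible K≤b b≤) with b ≤? K + r
  ... | yes room = valid-cons z≤n (⊔-identityʳ K) (least-valid K 0ℙ r (feasible K≤b room))
  ... | no  full = valid-cons ≤-refl (K⊔sK K)
          (least-valid (suc K) _ r (feasible (≤-trans (s≤s (m≤m+n K r)) (≰⇒> full)) (subst (b ≤_) (+-suc K r) b≤)))
  least-valid K 1ℙ (suc r) (feasible K≤b b≤) with K <? b
  ... | yes K<b = valid-cons ≤-refl (K⊔sK K) (least-valid (suc K) _ r (feasible K<b (subst (b ≤_) (+-suc K r) b≤)))
  ... | no  K≮b = valid-cons (≤-trans b≤K (n≤1+n K)) (m≥n⇒m⊔n≡m b≤K)
          (least-valid K _ r (feasible K≤b (≤-trans b≤K (m≤m+n K r))))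
    where b≤K = ≮⇒≥ K≮b

  least-minimal : ∀ K π a w → parity a ≡ π → Valid K w →
    least K π (length w) ≡ w ⊎ RGCFrom a (least K π (length w)) w
  least-minimal K π a [] _ _ = inj₁ refl
  least-minimal K 0ℙ a (x ∷ w) pa v with b ≤? K + length w
  ... | yes _ with x ≟ 0
  ...   | yes refl = same-head (least-minimal K 0ℙ (a + 0) w (parity-step a 0 pa) (valid-tail (⊔-identityʳ K) v))
  ...   | no  x≢0  = inj₂ (inj₂ (x≢0 ∘ sym , inj₁ (parity⇒%2 a pa , n≢0⇒n>0 x≢0)))
  least-minimal K 0ℙ a (x ∷ w) pa v | no full with x ≟ suc K
  ...   | yes refl = same-head (least-minimal (suc K) _ (a + suc K) w (parity-step a (suc K) pa) (valid-tail (K⊔sK K) v))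
  ...   | no  x≢sK = ⊥-elim (full (subst (λ m → b ≤ m + length w)
            (m≥n⇒m⊔n≡m (≤-pred (≤∧≢⇒< (head-growth v) x≢sK))) (reach (valid⇒feasible w (valid-tail refl v)))))
  least-minimal K 1ℙ a (x ∷ w) pa v with K <? b
  ... | yes _ with x ≟ suc K
  ...   | yes refl = same-head (least-minimal (suc K) _ (a + suc K) w (parity-step a (suc K) pa) (valid-tail (K⊔sK K) v))
  ...   | no  x≢sK = inj₂ (inj₂ (x≢sK ∘ sym , inj₂ (parity⇒%2 a pa , ≤∧≢⇒< (head-growth v) x≢sK)))
  least-minimal K 1ℙ a (x ∷ w) pa v | no K≮b with x ≟ b
  ...   | yes refl = same-head (least-minimal K _ (a + b) w (parity-step a b pa) (valid-tail (m≥n⇒m⊔n≡m (≮⇒≥ K≮b)) v))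
  ...   | no  x≢b  = inj₂ (inj₂ (x≢b ∘ sym , inj₂ (parity⇒%2 a pa , ≤∧≢⇒< (head≤b v) x≢b)))

  least-maximal : ∀ K π a w → parity (suc a) ≡ π → Valid K w →
    least K π (length w) ≡ w ⊎ RGCFrom a w (least K π (length w))
  least-maximal K π a w pa v = Sum.map₂ (reverse a _ w) (least-minimal K π (suc a) w pa v)

  -- Under even parity, raising the maximum by one changes one position: the
  -- switch from zeros to the staircase happens one step later.
  shift-even : ∀ K r → K < b → b ≤ K + r → hamming (least K 0ℙ r) (least (suc K) 0ℙ r) ≤ 1
  shift-even K zero    _   _  = z≤n
  shift-even K (suc r) K<b b≤ with b ≤? K + r | b ≤? suc K + r
  ... | yes room | yes _    = shift-even K r K<b room
  ... | yes room | no  full = ⊥-elim (full (≤-trans room (+-monoˡ-≤ r (n≤1+n K))))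
  ... | no  full | yes room =
    s≤s (≤-reflexive (hamming-≡ (least-rigid (suc K) _ _ r (≤-antisym room (≰⇒> full)))))
  ... | no  _    | no  full = ⊥-elim (full (subst (b ≤_) (+-suc K r) b≤))

  -- After the odd-parity heads K+1 (from maximum K) and K+2 (from maximum K+1)
  -- the tails start from maxima K+1 and K+2 with opposite parities; the two
  -- lemmas below treat K odd and K even.  For K odd the second tail begins with
  -- 0 where the first begins with K+2, and they agree afterwards.
  odd-tails-odd : ∀ K r → parity K ≡ 1ℙ → suc K < b → b ≤ suc K + r →
    hamming (least (suc K) 1ℙ r) (least (suc (suc K)) 0ℙ r) ≤ 1
  odd-tails-odd K zero    _  _     _  = z≤n
  odd-tails-odd K (suc r) eK sK<b b≤
    rewrite least-climb {r = r} sK<b | least-room {suc (suc K)} {r} (subst (b ≤_) (+-suc (suc K) r) b≤) | eK =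
    s≤s (≤-reflexive (hamming-refl (least (suc (suc K)) 0ℙ r)))

  -- For K even the first tail is within distance 2 of least (K+3) 0ℙ (by
  -- 'shift-even' twice), which begins with 0 where the second begins with K+3.
  odd-tails-even : b % 2 ≡ 1 → ∀ K r → parity K ≡ 0ℙ → suc (suc K) ≤ b → b ≤ suc K + r →
    hamming (least (suc K) 0ℙ r) (least (suc (suc K)) 1ℙ r) ≤ 3
  odd-tails-even b-odd K zero    _  _      _  = z≤n
  odd-tails-even b-odd K (suc r) eK ssK≤b b≤ = begin
    hamming L₁ (least K₂ 1ℙ (suc r))  ≡⟨ cong (hamming L₁) climb ⟩
    hamming L₁ U                      ≤⟨ hamming-triangle L₁ L₂ U (length-eq (suc K) K₂) ⟩
    hamming L₁ L₂ + hamming L₂ U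
      ≤⟨ +-monoʳ-≤ (hamming L₁ L₂) (hamming-triangle L₂ L₃ U (length-eq K₂ K₃)) ⟩
    hamming L₁ L₂ + (hamming L₂ L₃ + hamming L₃ U)
      ≤⟨ +-mono-≤ (shift-even (suc K) (suc r) (≤-trans (n<1+n (suc K)) ssK≤b) b≤)
                  (+-mono-≤ (shift-even K₂ (suc r) K₂<b (≤-trans b≤ (n≤1+n _))) last-step) ⟩
    3                                 ∎
    where
    open ≤-Reasoning
    K₂ = suc (suc K)
    K₃ = suc K₂
    L₁ = least (suc K) 0ℙ (suc r)
    L₂ = least K₂ 0ℙ (suc r)
    L₃ = least K₃ 0ℙ (suc r)
    U  = K₃ ∷ least K₃ 0ℙ r
    length-eq : ∀ M N → length (least M 0ℙ (suc r)) ≡ length (least N 0ℙ (suc r))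
    length-eq M N = trans (least-length M 0ℙ (suc r)) (sym (least-length N 0ℙ (suc r)))
    -- K + 2 is even and b is odd, so K + 2 < b and the next head is K + 3.
    K₂<b : K₂ < b
    K₂<b = ≤∧≢⇒< ssK≤b λ K₂≡b →
      0≢1+n (trans (sym (parity⇒%2 K eK)) (trans (cong (_% 2) K₂≡b) b-odd))
    climb : least K₂ 1ℙ (suc r) ≡ U
    climb = trans (least-climb K₂<b) (cong (λ π → K₃ ∷ least K₃ π r) (trans (suc-homo-⁻¹ K) eK))
    room₃ : b ≤ K₃ + r
    room₃ = ≤-trans b≤ (≤-trans (≤-reflexive (cong suc (+-suc K r))) (n≤1+n _))
    last-step : hamming L₃ U ≤ 1
    last-step = ≤-reflexive (trans (cong (λ L → hamming L U) (least-room room₃))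
                                   (cong suc (hamming-refl (least K₃ 0ℙ r))))

  odd-tails : b % 2 ≡ 1 → ∀ K r → suc (suc K) ≤ b → b ≤ suc K + r →
    hamming (least (suc K) (parity (suc K) ⁻¹) r) (least (suc (suc K)) (parity K ⁻¹) r) ≤ 3
  odd-tails b-odd K r ssK≤b b≤ rewrite suc-homo-⁻¹ K with parity K in eK
  ... | 0ℙ = odd-tails-even b-odd K r eK ssK≤b b≤
  ... | 1ℙ = ≤-trans (odd-tails-odd K r eK ssK≤b b≤) (s≤s z≤n)

  shift : b % 2 ≡ 1 → ∀ K π r → suc K ≤ b → b ≤ K + r →
    hamming (least K π r) (least (suc K) π r) ≤ 4
  shift _     K 0ℙ r       K<b b≤ = ≤-trans (shift-even K r K<b b≤) (s≤s z≤n)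
  shift _     K 1ℙ zero    _   _  = z≤n
  shift b-odd K 1ℙ (suc r) K<b b≤ rewrite least-climb {r = r} K<b with suc K <? b
  ... | yes sK<b = ≤-trans (hamming-cons (suc K) (suc (suc K))
                       (least (suc K) (parity (suc K) ⁻¹) r) (least (suc (suc K)) (parity K ⁻¹) r))
                     (s≤s (odd-tails b-odd K r sK<b (subst (b ≤_) (+-suc K r) b≤)))
  ... | no  sK≮b = ≤-trans (≤-reflexive (hamming-≡ (cong (λ m → m ∷ least (suc K) (parity m ⁻¹) r)
                     (≤-antisym K<b (≮⇒≥ sK≮b))))) z≤n

  shift-≤1 : b % 2 ≡ 1 → ∀ K M π r → M ≡ K ⊎ M ≡ suc K → M ≤ b → b ≤ K + r →
    hamming (least K π r) (least M π r) ≤ 4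
  shift-≤1 _     K .K       π r (inj₁ refl) _   _  = ≤-trans (≤-reflexive (hamming-refl (least K π r))) z≤n
  shift-≤1 b-odd K .(suc K) π r (inj₂ refl) K<b b≤ = shift b-odd K π r K<b b≤

  NoneBetween : ℕ → ℕ → List ℕ → List ℕ → Set
  NoneBetween a K s t = ∀ u → length u ≡ length s → Valid K u → ¬ (RGCFrom a s u × RGCFrom a u t)

  no-candidate : ∀ {a K s t} z π L → length s ≡ suc L → z ≤ suc K → Feasible (K ⊔ z) L →
    NoneBetween a K s t →
    ¬ (RGCFrom a s (z ∷ least (K ⊔ z) π L) × RGCFrom a (z ∷ least (K ⊔ z) π L) t)
  no-candidate {K = K} z π L ls z≤ F gap = gap (z ∷ least (K ⊔ z) π L)
    (trans (cong suc (least-length (K ⊔ z) π L)) (sym ls)) (valid-cons z≤ refl (least-valid (K ⊔ z) π L F))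

  -- At a first difference x < y under even parity, y = x + 1: otherwise x + 1
  -- followed by a least tail would lie between.
  next-head : ∀ a K x y s t → a % 2 ≡ 0 → x < y → length s ≡ length t →
    Valid K (x ∷ s) → Valid K (y ∷ t) → NoneBetween a K (x ∷ s) (y ∷ t) → y ≡ suc x
  next-head a K x y s t even x<y ls vs vt gap with y ≟ suc x
  ... | yes y≡sx = y≡sx
  ... | no  y≢sx = ⊥-elim (no-candidate (suc x) 0ℙ (length s) refl (≤-trans x<y (head-growth vt)) F gap
          (inj₂ (<⇒≢ (n<1+n x) , inj₁ (even , n<1+n x)) , inj₂ (<⇒≢ sx<y , inj₁ (even , sx<y))))
    where
    sx<y = ≤∧≢⇒< x<y (y≢sx ∘ sym)
    Fs = valid⇒feasible s (valid-tail refl vs)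
    Ft = valid⇒feasible t (valid-tail refl vt)
    F : Feasible (K ⊔ suc x) (length s)
    F = feasible (≤-trans (⊔-monoʳ-≤ K (<⇒≤ sx<y)) (below Ft))
                 (≤-trans (reach Fs) (+-monoˡ-≤ (length s) (⊔-monoʳ-≤ K (n≤1+n x))))

  -- Heads x and x + 1 under even parity: the tail of the smaller sequence is the
  -- largest tail and that of the larger one the least tail; both start from the
  -- parity of a + x + 1, with maxima K ⊔ x and K ⊔ (x + 1).
  ascent-close : b % 2 ≡ 1 → ∀ a K x s t → a % 2 ≡ 0 → length s ≡ length t →
    Valid K (x ∷ s) → Valid K (suc x ∷ t) → NoneBetween a K (x ∷ s) (suc x ∷ t) →
    hamming (x ∷ s) (suc x ∷ t) ≤ 5
  ascent-close b-odd a K x s t even ls vs vt gap = begin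
    hamming (x ∷ s) (suc x ∷ t)  ≤⟨ hamming-cons x (suc x) s t ⟩
    suc (hamming s t)            ≡⟨ cong suc (cong₂ hamming (sym s-largest) (sym t-least′)) ⟩
    suc (hamming (least (K ⊔ x) π (length s)) (least (K ⊔ suc x) π (length s)))
      ≤⟨ s≤s (shift-≤1 b-odd (K ⊔ x) (K ⊔ suc x) π (length s) (⊔-suc K x) (below Ft) (reach Fs)) ⟩
    5                            ∎
    where
    open ≤-Reasoning
    π = parity (suc (a + x))
    Fs = valid⇒feasible s (valid-tail refl vs)
    Ft = valid⇒feasible t (valid-tail refl vt)
    x≺sx : ∀ {u w} → RGCFrom a (x ∷ u) (suc x ∷ w)
    x≺sx = inj₂ (<⇒≢ (n<1+n x) , inj₁ (even , n<1+n x))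
    t-least : least (K ⊔ suc x) π (length t) ≡ t
    t-least with least-minimal (K ⊔ suc x) π (a + suc x) t (cong parity (+-suc a x)) (valid-tail refl vt)
    ... | inj₁ e   = e
    ... | inj₂ l≺t = ⊥-elim (no-candidate (suc x) π (length t) (cong suc ls) (head-growth vt) Ft gap
                       (x≺sx , inj₁ (refl , l≺t)))
    t-least′ : least (K ⊔ suc x) π (length s) ≡ t
    t-least′ = trans (cong (least (K ⊔ suc x) π) ls) t-least
    s-largest : least (K ⊔ x) π (length s) ≡ s
    s-largest with least-maximal (K ⊔ x) π (a + x) s refl (valid-tail refl vs)
    ... | inj₁ e   = e
    ... | inj₂ s≺l = ⊥-elim (no-candidate x π (length s) refl (head-growth vs) Fs gap
                       (inj₁ (refl , s≺l) , x≺sx))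

  first-difference : b % 2 ≡ 1 → ∀ a K x y s t → a % 2 ≡ 0 → x < y → length s ≡ length t →
    Valid K (x ∷ s) → Valid K (y ∷ t) → NoneBetween a K (x ∷ s) (y ∷ t) →
    hamming (x ∷ s) (y ∷ t) ≤ 5
  first-difference b-odd a K x y s t even x<y ls vs vt gap with next-head a K x y s t even x<y ls vs vt gap
  ... | refl = ascent-close b-odd a K x s t even ls vs vt gap

  -- Consecutive valid continuations of a common prefix differ in at most 5
  -- positions: skip the common prefix, then analyse the first difference,
  -- reducing odd parity to even parity by reversal.
  consecutive-close : b % 2 ≡ 1 → ∀ a K s t → length s ≡ length t → Valid K s → Valid K t →
    RGCFrom a s t → NoneBetween a K s t → hamming s t ≤ 5
  consecutive-close _ a K []      _       _ _ _ () _
  consecutive-close _ a K (_ ∷ _) []      _ _ _ () _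
  consecutive-close b-odd a K (x ∷ s) (y ∷ t) ls vs vt (inj₁ (refl , s≺t)) gap =
    subst (_≤ 5) (sym (hamming-same-head x s t))
      (consecutive-close b-odd (a + x) (K ⊔ x) s t (suc-injective ls) (valid-tail refl vs) (valid-tail refl vt) s≺t
        (λ u lu vu (s≺u , u≺t) → gap (x ∷ u) (cong suc lu) (valid-cons (head-growth vs) refl vu)
                                     (inj₁ (refl , s≺u) , inj₁ (refl , u≺t))))
  consecutive-close b-odd a K (x ∷ s) (y ∷ t) ls vs vt (inj₂ (_ , inj₁ (even , x<y))) gap =
    first-difference b-odd a K x y s t even x<y (suc-injective ls) vs vt gap
  consecutive-close b-odd a K (x ∷ s) (y ∷ t) ls vs vt (inj₂ (_ , inj₂ (odd , y<x))) gap =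
    subst (_≤ 5) (hamming-sym (y ∷ t) (x ∷ s))
      (first-difference b-odd (suc a) K y x t s (odd⇒suc-even a odd) y<x (sym (suc-injective ls)) vt vs
        (λ u lu vu (t≺u , u≺s) → gap u (trans lu (sym ls)) vu (reverse a _ _ u≺s , reverse a _ _ t≺u)))

-- Every element of R*_n(b) starts with 0; after this common head the tails are
-- consecutive valid continuations from maximum 0 and prefix sum 0.
theorem3 : (b n : ℕ) → 1 ≤ b → b % 2 ≡ 1 → b < n →
    (s t : List ℕ) → InRStar n b s → InRStar n b t → s ≺ t →
    ((u : List ℕ) → InRStar n b u → ¬ (s ≺ u × u ≺ t)) →
    hamming s t ≤ 5
theorem3 b n _ _ _ []      _  (_ , () , _) _ _ _
theorem3 b n _ _ _ (_ ∷ _) [] _ (_ , () , _) _ _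
theorem3 b n _ b-odd _ (x ∷ s) (y ∷ t) (ls , (refl , gs) , ms) (lt , (refl , gt) , mt) (inj₁ (_ , s≺t)) gap =
  consecutive-close b-odd 0 0 s t (suc-injective (trans ls (sym lt))) (valid gs ms) (valid gt mt) s≺t tails-gap
  where
  open Tails b
  tails-gap : NoneBetween 0 0 s t
  tails-gap u lu (valid gu mu) (s≺u , u≺t) =
    gap (0 ∷ u) (trans (cong suc lu) ls , (refl , gu) , mu) (inj₁ (refl , s≺u) , inj₁ (refl , u≺t))
theorem3 b n _ _ _ (x ∷ s) (y ∷ t) (_ , (refl , _) , _) (_ , (refl , _) , _) (inj₂ (0≢0 , _)) _ =
  ⊥-elim (0≢0 refl)
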